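{- Let $G$ be a Naji graph with an edge $e=vw$, and suppose $G$ and $G-e$ share a Naji solution $\beta$. Then $G$ and $G-e$ have Naji solutions $\beta_1$ and $\beta_2$ respectively such that (a) $\beta_1$ and $\beta_2$ agree on every ordered pair other than $(v,w)$ and $(w,v)$, and $\beta_1(v,w)=\beta_2(w,v)$ and $\beta_1(w,v)=\beta_2(v,w)$; and (b) $\beta_1(x,v)=\beta_1(x,w)$ for all $x\notin\{v,w\}$.
   Context: All graphs are finite and simple; $G-e$ has the same vertex set as $G$ with the edge $e$ removed. For a graph $H$ and each ordered pair $(v,w)$ of distinct vertices there is a variable $\beta(v,w)$. The Naji equations of $H$ are: (a) for each edge $vw$, $\beta(v,w)+\beta(w,v)=1$; (b) if $v,w,x$ are distinct with $vw\in E(H)$ and $vx,wx\notin E(H)$, then $\beta(x,v)+\beta(x,w)=0$; (c) if $v,w,x$ are distinct with $vw,vx\in E(H)$ and $wx\notin E(H)$, then $\beta(v,w)+\beta(v,x)+\beta(w,x)+\beta(x,w)=1$. A Naji solution of $H$ is a function from ordered pairs of distinct vertices to $GF(2)$ satisfying these equations; $H$ is a Naji graph if it has one; "$G$ and $G-e$ share a Naji solution $\beta$" means $\beta$ is a Naji solution of both. -}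

module Defs where

open import Data.Nat using (ℕ)
open import Data.Fin using (Fin; _≟_)
open import Data.Bool using (Bool; true; false; _xor_; _∧_; not)
open import Data.Product using (Σ; _×_; _,_)
open import Relation.Nullary using (¬_; does)
open import Relation.Binary.PropositionalEquality using (_≡_)

record Graph (n : ℕ) : Set where
  field
    adj   : Fin n → Fin n → Bool
    sym   : ∀ u v → adj u v ≡ adj v u
    irrefl : ∀ v → adj v v ≡ false
open Graph public

Edge : ∀ {n} → Graph n → Fin n → Fin n → Set
Edge G u v = adj G u v ≡ true

NonEdge : ∀ {n} → Graph n → Fin n → Fin n → Set
NonEdge G u v = adj G u v ≡ false

samePair : ∀ {n} → Fin n → Fin n → Fin n → Fin n → Bool
samePair v w a b =
  (does (a ≟ v) ∧ does (b ≟ w)) Data.Bool.∨ (does (a ≟ w) ∧ does (b ≟ v))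

deleteEdge : ∀ {n} → (G : Graph n) → Fin n → Fin n → Graph n
deleteEdge G v w = record
  { adj = λ a b → adj G a b ∧ not (samePair v w a b)
  ; sym = symProof
  ; irrefl = λ a → irreflProof a
  }
  where
  open import Relation.Binary.PropositionalEquality using (cong₂; refl)
  open import Data.Bool.Properties using (∨-comm)
  samePair-sym : ∀ a b → samePair v w a b ≡ samePair v w b a
  samePair-sym a b =
    Relation.Binary.PropositionalEquality.trans
      (cong₂ Data.Bool._∨_ (Data.Bool.Properties.∧-comm (does (a ≟ v)) (does (b ≟ w)))
                          (Data.Bool.Properties.∧-comm (does (a ≟ w)) (does (b ≟ v))))
      (∨-comm (does (b ≟ w) ∧ does (a ≟ v)) (does (b ≟ v) ∧ does (a ≟ w)))
  symProof : ∀ a b → (adj G a b ∧ not (samePair v w a b)) ≡ (adj G b a ∧ not (samePair v w b a))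
  symProof a b = cong₂ (λ x y → x ∧ not y) (sym G a b) (samePair-sym a b)
  irreflProof : ∀ a → (adj G a a ∧ not (samePair v w a a)) ≡ false
  irreflProof a = Relation.Binary.PropositionalEquality.cong (λ x → x ∧ not (samePair v w a a)) (irrefl G a)

-- Assignments of GF(2) values (Bool with xor as addition) to ordered pairs.
-- Values on diagonal pairs (v,v) are irrelevant and never constrained.
Assignment : ℕ → Set
Assignment n = Fin n → Fin n → Bool

record NajiSolution {n : ℕ} (H : Graph n) (β : Assignment n) : Set where
  field
    eqA : ∀ v w → Edge H v w → (β v w xor β w v) ≡ true
    eqB : ∀ v w x → ¬ v ≡ w → ¬ v ≡ x → ¬ w ≡ x →
          Edge H v w → NonEdge H v x → NonEdge H w x →
          (β x v xor β x w) ≡ false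
    eqC : ∀ v w x → ¬ v ≡ w → ¬ v ≡ x → ¬ w ≡ x →
          Edge H v w → Edge H v x → NonEdge H w x →
          (β v w xor β v x xor β w x xor β x w) ≡ true

IsNajiGraph : ∀ {n} → Graph n → Set
IsNajiGraph H = Σ (Assignment _) (NajiSolution H)

-- Over GF(2) the Naji equations are affine, so adding a solution of the homogeneous
-- system to a Naji solution gives another one.  For every vertex u the assignment
-- switch H u (the indicator of row u plus that of the pairs (a, u) with a ~ u) solves
-- the homogeneous system.  Switching β at both ends of e, once in G and once in G - e,
-- gives β₁ and β₂: the two switchings differ only at (v, w) and (w, v), where the edge
-- equation of vw exchanges their values.  Part (b) reduces to
-- β(x,v) + β(x,w) = [x ~ v] + [x ~ w] for x ∉ {v, w}, obtained by adding up Naji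
-- equations of G and of G - e according to the adjacencies of x.
module Submission where

open import Defs hiding (sym)
open import Data.Nat using (ℕ)
open import Data.Fin using (Fin; _≟_)
open import Data.Bool using (true; false; not; _∧_; _∨_; _xor_)
open import Data.Bool.Properties using (∧-zeroʳ; ∧-identityʳ; xor-identityʳ; xor-comm)
open import Data.Bool.Solver using (module xor-∧-Solver)
open xor-∧-Solver using (solve; _:+_; _:=_; con)
open import Data.Empty using (⊥-elim)
open import Data.Product using (Σ; _×_; _,_; proj₁)
open import Function using (_∘_)
open import Relation.Nullary using (¬_; does; yes; no)
open import Relation.Nullary.Decidable using (dec-true; dec-false)
open import Relation.Binary.PropositionalEquality
  using (_≡_; _≢_; refl; sym; trans; cong; cong₂; ≢-sym; module ≡-Reasoning)

open ≡-Reasoning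

private
  variable
    n : ℕ
    H : Graph n
    a b u v w x : Fin n
    β δ : Assignment n

xor-interchange : ∀ a b c d → ((a xor b) xor (c xor d)) ≡ ((a xor c) xor (b xor d))
xor-interchange = solve 4 (λ a b c d → (a :+ b) :+ (c :+ d) := (a :+ c) :+ (b :+ d)) refl

xor-interchange₄ : ∀ a b c d p q r s →
  ((a xor p) xor (b xor q) xor (c xor r) xor (d xor s)) ≡
  ((a xor b xor c xor d) xor (p xor q xor r xor s))
xor-interchange₄ = solve 8 (λ a b c d p q r s →
  (a :+ p) :+ ((b :+ q) :+ ((c :+ r) :+ (d :+ s))) :=
  (a :+ (b :+ (c :+ d))) :+ (p :+ (q :+ (r :+ s)))) refl

xor≡true⇒≡not : ∀ a b → a xor b ≡ true → a ≡ not b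
xor≡true⇒≡not false true  _ = refl
xor≡true⇒≡not true  false _ = refl

xor-transpose : ∀ a b c d → a xor b ≡ c xor d → a xor c ≡ b xor d
xor-transpose a b c d h = begin
  a xor c
    ≡⟨ solve 3 (λ a b c → a :+ c := (a :+ b) :+ (b :+ c)) refl a b c ⟩
  (a xor b) xor (b xor c)
    ≡⟨ cong (_xor (b xor c)) h ⟩
  (c xor d) xor (b xor c)
    ≡⟨ solve 3 (λ b c d → (c :+ d) :+ (b :+ c) := b :+ d) refl b c d ⟩
  b xor d
    ∎

xor-elim₂ : ∀ a b c d → a xor b xor c xor d ≡ true → c xor d ≡ true →
            a xor b ≡ false
xor-elim₂ a b c d abcd cd = begin
  a xor b
    ≡⟨ solve 4 (λ a b c d → a :+ b := (a :+ (b :+ (c :+ d))) :+ (c :+ d)) refl a b c d ⟩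
  (a xor b xor c xor d) xor (c xor d)
    ≡⟨ cong₂ _xor_ abcd cd ⟩
  false
    ∎

xor-elim₄ : ∀ p q r s t u → p xor q xor r xor s ≡ true → q xor t ≡ true →
            r xor u ≡ false → p xor u ≡ true → t xor s ≡ true
xor-elim₄ p q r s t u pqrs qt ru pu = begin
  t xor s
    ≡⟨ solve 6 (λ p q r s t u → t :+ s :=
         (q :+ t) :+ ((p :+ (q :+ (r :+ s))) :+ ((r :+ u) :+ (p :+ u)))) refl p q r s t u ⟩
  (q xor t) xor (p xor q xor r xor s) xor (r xor u) xor (p xor u)
    ≡⟨ cong₂ _xor_ qt (cong₂ _xor_ pqrs (cong₂ _xor_ ru pu)) ⟩
  true
    ∎

Edge-sym : (H : Graph n) → Edge H a b → Edge H b a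
Edge-sym {a = a} {b = b} H ab = trans (Graph.sym H b a) ab

NonEdge-sym : (H : Graph n) → NonEdge H a b → NonEdge H b a
NonEdge-sym {a = a} {b = b} H ab = trans (Graph.sym H b a) ab

Edge⇒≢ : (H : Graph n) → Edge H a b → a ≢ b
Edge⇒≢ {a = a} H ab refl with trans (sym ab) (Graph.irrefl H a)
... | ()

does-∧-≡false : ¬ (a ≡ v × b ≡ w) → does (a ≟ v) ∧ does (b ≟ w) ≡ false
does-∧-≡false {a = a} {v = v} {b = b} {w = w} ¬ab with a ≟ v | b ≟ w
... | no _     | _        = refl
... | yes _    | no _     = refl
... | yes refl | yes refl = ⊥-elim (¬ab (refl , refl))

samePair-≡false : ¬ (a ≡ v × b ≡ w) → ¬ (a ≡ w × b ≡ v) → samePair v w a b ≡ false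
samePair-≡false ¬vw ¬wv = cong₂ _∨_ (does-∧-≡false ¬vw) (does-∧-≡false ¬wv)

samePair-refl : (v w : Fin n) → samePair v w v w ≡ true
samePair-refl v w rewrite dec-true (v ≟ v) refl | dec-true (w ≟ w) refl = refl

adj-deleteEdge : (G : Graph n) → ¬ (a ≡ v × b ≡ w) → ¬ (a ≡ w × b ≡ v) →
                 adj (deleteEdge G v w) a b ≡ adj G a b
adj-deleteEdge {a = a} {b = b} G ¬vw ¬wv
  rewrite samePair-≡false ¬vw ¬wv = ∧-identityʳ (adj G a b)

deleteEdge-nonEdge : (G : Graph n) (v w : Fin n) → NonEdge (deleteEdge G v w) v w
deleteEdge-nonEdge G v w rewrite samePair-refl v w = ∧-zeroʳ (adj G v w)

infixl 6 _⊕_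

_⊕_ : Assignment n → Assignment n → Assignment n
(β ⊕ δ) a b = β a b xor δ a b

record HomogeneousNajiSolution {n : ℕ} (H : Graph n) (δ : Assignment n) : Set where
  field
    eqA⁰ : ∀ v w → Edge H v w → (δ v w xor δ w v) ≡ false
    eqB⁰ : ∀ v w x → ¬ v ≡ w → ¬ v ≡ x → ¬ w ≡ x →
           Edge H v w → NonEdge H v x → NonEdge H w x →
           (δ x v xor δ x w) ≡ false
    eqC⁰ : ∀ v w x → ¬ v ≡ w → ¬ v ≡ x → ¬ w ≡ x →
           Edge H v w → Edge H v x → NonEdge H w x →
           (δ v w xor δ v x xor δ w x xor δ x w) ≡ false

open NajiSolution
open HomogeneousNajiSolution

NajiSolution-⊕ : NajiSolution H β → HomogeneousNajiSolution H δ → NajiSolution H (β ⊕ δ)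
NajiSolution-⊕ {β = β} {δ = δ} sol hom = record
  { eqA = λ v w vw →
      trans (xor-interchange (β v w) (δ v w) (β w v) (δ w v))
            (cong₂ _xor_ (eqA sol v w vw) (eqA⁰ hom v w vw))
  ; eqB = λ v w x v≢w v≢x w≢x vw vx wx →
      trans (xor-interchange (β x v) (δ x v) (β x w) (δ x w))
            (cong₂ _xor_ (eqB sol v w x v≢w v≢x w≢x vw vx wx)
                         (eqB⁰ hom v w x v≢w v≢x w≢x vw vx wx))
  ; eqC = λ v w x v≢w v≢x w≢x vw vx wx →
      trans (xor-interchange₄ (β v w) (β v x) (β w x) (β x w) (δ v w) (δ v x) (δ w x) (δ x w))
            (cong₂ _xor_ (eqC sol v w x v≢w v≢x w≢x vw vx wx)
                         (eqC⁰ hom v w x v≢w v≢x w≢x vw vx wx))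
  }

switch : Graph n → Fin n → Assignment n
switch H u a b = does (a ≟ u) xor (does (b ≟ u) ∧ adj H a u)

switch-homogeneous : (H : Graph n) (u : Fin n) → HomogeneousNajiSolution H (switch H u)
switch-homogeneous H u = record { eqA⁰ = switch-eqA ; eqB⁰ = switch-eqB ; eqC⁰ = switch-eqC }
  where
  switch-eqA : ∀ v w → Edge H v w → (switch H u v w xor switch H u w v) ≡ false
  switch-eqA v w vw with v ≟ u | w ≟ u
  ... | yes refl | yes refl rewrite Graph.irrefl H v = refl
  ... | yes refl | no _     rewrite Edge-sym H vw = refl
  ... | no _     | yes refl rewrite vw = refl
  ... | no _     | no _     = refl

  switch-eqB : ∀ v w x → ¬ v ≡ w → ¬ v ≡ x → ¬ w ≡ x →
               Edge H v w → NonEdge H v x → NonEdge H w x →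
               (switch H u x v xor switch H u x w) ≡ false
  switch-eqB v w x v≢w v≢x w≢x _ vx wx with x ≟ u | v ≟ u | w ≟ u
  ... | yes refl | yes refl | _        = ⊥-elim (v≢x refl)
  ... | yes refl | no _     | yes refl = ⊥-elim (w≢x refl)
  ... | yes refl | no _     | no _     = refl
  ... | no _     | yes refl | yes refl = ⊥-elim (v≢w refl)
  ... | no _     | yes refl | no _     rewrite NonEdge-sym H vx = refl
  ... | no _     | no _     | yes refl rewrite NonEdge-sym H wx = refl
  ... | no _     | no _     | no _     = refl

  switch-eqC : ∀ v w x → ¬ v ≡ w → ¬ v ≡ x → ¬ w ≡ x →
               Edge H v w → Edge H v x → NonEdge H w x →
               (switch H u v w xor switch H u v x xor switch H u w x xor switch H u x w) ≡ false
  switch-eqC v w x v≢w v≢x w≢x vw vx wx with v ≟ u | w ≟ u | x ≟ u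
  ... | yes refl | yes refl | _        = ⊥-elim (v≢w refl)
  ... | yes refl | no _     | yes refl = ⊥-elim (v≢x refl)
  ... | yes refl | no _     | no _     = refl
  ... | no _     | yes refl | yes refl = ⊥-elim (w≢x refl)
  ... | no _     | yes refl | no _     rewrite vw | NonEdge-sym H wx = refl
  ... | no _     | no _     | yes refl rewrite vx | wx = refl
  ... | no _     | no _     | no _     = refl

switch-row : (H : Graph n) (u b : Fin n) → switch H u u b ≡ true
switch-row H u b rewrite dec-true (u ≟ u) refl | Graph.irrefl H u =
  cong not (∧-zeroʳ (does (b ≟ u)))

switch-column : (H : Graph n) → a ≢ u → switch H u a u ≡ adj H a u
switch-column {a = a} {u = u} H a≢u
  rewrite dec-false (a ≟ u) a≢u | dec-true (u ≟ u) refl = refl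

switch-off : (H : Graph n) → a ≢ u → b ≢ u → switch H u a b ≡ false
switch-off {a = a} {u = u} {b = b} H a≢u b≢u
  rewrite dec-false (a ≟ u) a≢u | dec-false (b ≟ u) b≢u = refl

switch-deleteEdge : (G : Graph n) (u : Fin n) →
                    ¬ (a ≡ v × b ≡ w) → ¬ (a ≡ w × b ≡ v) →
                    switch (deleteEdge G v w) u a b ≡ switch G u a b
switch-deleteEdge {a = a} {b = b} G u ¬vw ¬wv with b ≟ u
... | no _     = refl
... | yes refl = cong (does (a ≟ b) xor_) (adj-deleteEdge G ¬vw ¬wv)

switchEnds : Graph n → Fin n → Fin n → Assignment n → Assignment n
switchEnds H v w β = β ⊕ switch H v ⊕ switch H w

switchEnds-solution : NajiSolution H β → NajiSolution H (switchEnds H v w β)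
switchEnds-solution {H = H} {v = v} {w = w} sol =
  NajiSolution-⊕ (NajiSolution-⊕ sol (switch-homogeneous H v)) (switch-homogeneous H w)

switchEnds-deleteEdge : (G : Graph n) (β : Assignment n) →
                        ¬ (a ≡ v × b ≡ w) → ¬ (a ≡ w × b ≡ v) →
                        switchEnds G v w β a b ≡ switchEnds (deleteEdge G v w) v w β a b
switchEnds-deleteEdge {a = a} {v = v} {b = b} {w = w} G β ¬vw ¬wv =
  sym (cong₂ (λ s t → (β a b xor s) xor t)
             (switch-deleteEdge G v ¬vw ¬wv) (switch-deleteEdge G w ¬vw ¬wv))

switchEnds-vw : (H : Graph n) (β : Assignment n) → v ≢ w →
                switchEnds H v w β v w ≡ not (adj H v w) xor β v w
switchEnds-vw {v = v} {w = w} H β v≢w = begin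
  (β v w xor switch H v v w) xor switch H w v w
    ≡⟨ cong₂ (λ s t → (β v w xor s) xor t) (switch-row H v w) (switch-column H v≢w) ⟩
  (β v w xor true) xor adj H v w
    ≡⟨ solve 2 (λ b c → (b :+ con true) :+ c := (con true :+ c) :+ b) refl (β v w) (adj H v w) ⟩
  not (adj H v w) xor β v w
    ∎

switchEnds-wv : (H : Graph n) (β : Assignment n) → v ≢ w →
                switchEnds H v w β w v ≡ not (adj H w v) xor β w v
switchEnds-wv {v = v} {w = w} H β v≢w = begin
  (β w v xor switch H v w v) xor switch H w w v
    ≡⟨ cong₂ (λ s t → (β w v xor s) xor t) (switch-column H (≢-sym v≢w)) (switch-row H w v) ⟩
  (β w v xor adj H w v) xor true
    ≡⟨ solve 2 (λ b c → (b :+ c) :+ con true := (con true :+ c) :+ b) refl (β w v) (adj H w v) ⟩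
  not (adj H w v) xor β w v
    ∎

switchEnds-transposes : {G : Graph n} → Edge G v w → NajiSolution G β →
  switchEnds G v w β v w ≡ switchEnds (deleteEdge G v w) v w β w v ×
  switchEnds G v w β w v ≡ switchEnds (deleteEdge G v w) v w β v w
switchEnds-transposes {v = v} {w = w} {β = β} {G = G} vw sol = at-vw , at-wv
  where
  v≢w = Edge⇒≢ G vw
  G′ = deleteEdge G v w
  v≁′w = deleteEdge-nonEdge G v w
  w≁′v = NonEdge-sym G′ v≁′w

  at-vw : switchEnds G v w β v w ≡ switchEnds G′ v w β w v
  at-vw = begin
    switchEnds G v w β v w      ≡⟨ switchEnds-vw G β v≢w ⟩
    not (adj G v w) xor β v w   ≡⟨ cong (λ c → not c xor β v w) vw ⟩
    β v w                       ≡⟨ xor≡true⇒≡not (β v w) (β w v) (eqA sol v w vw) ⟩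
    not (β w v)                 ≡⟨ cong (λ c → not c xor β w v) (sym w≁′v) ⟩
    not (adj G′ w v) xor β w v  ≡⟨ sym (switchEnds-wv G′ β v≢w) ⟩
    switchEnds G′ v w β w v     ∎

  at-wv : switchEnds G v w β w v ≡ switchEnds G′ v w β v w
  at-wv = begin
    switchEnds G v w β w v      ≡⟨ switchEnds-wv G β v≢w ⟩
    not (adj G w v) xor β w v   ≡⟨ cong (λ c → not c xor β w v) (Edge-sym G vw) ⟩
    β w v                       ≡⟨ xor≡true⇒≡not (β w v) (β v w) (eqA sol w v (Edge-sym G vw)) ⟩
    not (β v w)                 ≡⟨ cong (λ c → not c xor β v w) (sym v≁′w) ⟩
    not (adj G′ v w) xor β v w  ≡⟨ sym (switchEnds-vw G′ β v≢w) ⟩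
    switchEnds G′ v w β v w     ∎

switchEnds-column-v : (H : Graph n) (β : Assignment n) → v ≢ w → x ≢ v → x ≢ w →
                      switchEnds H v w β x v ≡ β x v xor adj H x v
switchEnds-column-v {v = v} {w = w} {x = x} H β v≢w x≢v x≢w =
  trans (cong₂ (λ s t → (β x v xor s) xor t)
               (switch-column H x≢v) (switch-off H x≢w v≢w))
        (xor-identityʳ _)

switchEnds-column-w : (H : Graph n) (β : Assignment n) → v ≢ w → x ≢ v → x ≢ w →
                      switchEnds H v w β x w ≡ β x w xor adj H x w
switchEnds-column-w {v = v} {w = w} {x = x} H β v≢w x≢v x≢w =
  trans (cong₂ (λ s t → (β x w xor s) xor t)
               (switch-off H x≢v (≢-sym v≢w)) (switch-column H x≢w))
        (cong (_xor adj H x w) (xor-identityʳ (β x w)))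

switchEnds-balanced : (H : Graph n) (β : Assignment n) → v ≢ w → x ≢ v → x ≢ w →
                      β x v xor β x w ≡ adj H x v xor adj H x w →
                      switchEnds H v w β x v ≡ switchEnds H v w β x w
switchEnds-balanced {v = v} {w = w} {x = x} H β v≢w x≢v x≢w parity = begin
  switchEnds H v w β x v  ≡⟨ switchEnds-column-v H β v≢w x≢v x≢w ⟩
  β x v xor adj H x v     ≡⟨ xor-transpose (β x v) (β x w) (adj H x v) (adj H x w) parity ⟩
  β x w xor adj H x w     ≡⟨ sym (switchEnds-column-w H β v≢w x≢v x≢w) ⟩
  switchEnds H v w β x w  ∎

shared-solution-parity : (G : Graph n) → Edge G v w →
  NajiSolution G β → NajiSolution (deleteEdge G v w) β →
  x ≢ v → x ≢ w → β x v xor β x w ≡ adj G x v xor adj G x w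
shared-solution-parity {v = v} {w = w} {β = β} {x = x} G vw sol sol′ x≢v x≢w =
  by-adjacency (adj G x v) (adj G x w) refl refl
  where
  v≢w = Edge⇒≢ G vw
  v≢x = ≢-sym x≢v
  w≢x = ≢-sym x≢w
  v≁′w = deleteEdge-nonEdge G v w
  w≁′v = NonEdge-sym (deleteEdge G v w) v≁′w

  kept : ∀ {u c} → adj G x u ≡ c → adj (deleteEdge G v w) x u ≡ c
  kept = trans (adj-deleteEdge G (x≢v ∘ proj₁) (x≢w ∘ proj₁))

  by-adjacency : ∀ p q → adj G x v ≡ p → adj G x w ≡ q → β x v xor β x w ≡ p xor q
  by-adjacency false false xv xw =
    eqB sol v w x v≢w v≢x w≢x vw (NonEdge-sym G xv) (NonEdge-sym G xw)
  by-adjacency true true xv xw =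
    xor-elim₂ (β x v) (β x w) (β v w) (β w v)
      (eqC sol′ x v w x≢v x≢w v≢w (kept xv) (kept xw) v≁′w)
      (eqA sol v w vw)
  by-adjacency true false xv xw =
    xor-elim₄ (β v w) (β v x) (β w x) (β x w) (β x v) (β w v)
      (eqC sol v w x v≢w v≢x w≢x vw (Edge-sym G xv) (NonEdge-sym G xw))
      (eqA sol v x (Edge-sym G xv))
      (eqB sol′ x v w x≢v x≢w v≢w (kept xv) (kept xw) v≁′w)
      (eqA sol v w vw)
  by-adjacency false true xv xw = trans (xor-comm (β x v) (β x w)) (
    xor-elim₄ (β w v) (β w x) (β v x) (β x v) (β x w) (β v w)
      (eqC sol w v x (≢-sym v≢w) w≢x v≢x (Edge-sym G vw) (Edge-sym G xw) (NonEdge-sym G xv))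
      (eqA sol w x (Edge-sym G xw))
      (eqB sol′ x w v x≢w x≢v (≢-sym v≢w) (kept xw) (kept xv) w≁′v)
      (eqA sol w v (Edge-sym G vw)))

corollary28 : ∀ {n : ℕ} (G : Graph n) → IsNajiGraph G →
    (v w : Fin n) → Edge G v w →
    (β : Assignment n) → NajiSolution G β → NajiSolution (deleteEdge G v w) β →
    Σ (Assignment n) λ β₁ → Σ (Assignment n) λ β₂ →
      NajiSolution G β₁ × NajiSolution (deleteEdge G v w) β₂ ×
      ((∀ a b → ¬ a ≡ b → ¬ (a ≡ v × b ≡ w) → ¬ (a ≡ w × b ≡ v) → β₁ a b ≡ β₂ a b) ×
       β₁ v w ≡ β₂ w v × β₁ w v ≡ β₂ v w) ×
      (∀ x → ¬ x ≡ v → ¬ x ≡ w → β₁ x v ≡ β₁ x w)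
corollary28 G _ v w vw β sol sol′ =
  switchEnds G v w β , switchEnds (deleteEdge G v w) v w β ,
  switchEnds-solution sol , switchEnds-solution sol′ ,
  ((λ _ _ _ → switchEnds-deleteEdge G β) , switchEnds-transposes vw sol) ,
  λ x x≢v x≢w → switchEnds-balanced G β (Edge⇒≢ G vw) x≢v x≢w
                  (shared-solution-parity G vw sol sol′ x≢v x≢w)
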